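{- For every $\pi\in\mathfrak{S}_n(321)$, $\lambda(\pi)$ is a $321$-avoiding tree and $\mathcal{S}(\pi)=\lambda^{ -1}\circ\Theta\circ\lambda(\pi)$.
   Context: Stack-sorting: $\mathcal{S}(\emptyset)=\emptyset$, $\mathcal{S}(\alpha\,m\,\beta)=\mathcal{S}(\alpha)\mathcal{S}(\beta)m$ with $m$ the largest letter. $\lambda$: for a word with distinct letters, $\lambda(\emptyset)$ is empty and $\lambda(\sigma\,i\,\tau)$, $i$ the smallest letter, is the increasing binary tree with root $i$, left subtree $\lambda(\sigma)$, right subtree $\lambda(\tau)$; $\lambda^{ -1}$ reads labels in in-order. In an increasing binary tree $T$, the right arm $\mathsf{RA}(T)$ is the maximal path from the root using right edges only; a right chain is a maximal path, other than the right arm, consisting only of right edges; if its first node is the left child of $v$ it is denoted $C_v$; $C_v<C_w$ means every label of $C_v$ is smaller than every label of $C_w$. A right leaf is a node with no right child not on the right arm. $T$ is a $321$-avoiding tree if (1) the path from the root to every right leaf contains exactly one left edge, and (2) for any two right chains, $C_v<C_w$ iff $v<w$. For $u\in\mathsf{RA}(T)$, $T_r(u)$ is the right subtree of $u$. For a right leaf $v$ of a $321$-avoiding tree $T$, $v$ is the last node of a right chain $C_p$ with $p\in\mathsf{RA}(T)$; let $\mathsf{rft}(v)$ be the first node in in-order in $T_r(p)$ whose label exceeds $v$, if any. $\theta_v(T)$ is defined by: (a) if $\mathsf{rft}(v)$ lies on the right arm, cut $v$ off and insert it into the right arm so that $v$ becomes the parent of $\mathsf{rft}(v)$ (taking the place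 of $\mathsf{rft}(v)$, with $\mathsf{rft}(v)$ as its right child); (b) if $\mathsf{rft}(v)$ lies on a right chain $C_w$ (then it is the first node of $C_w$), cut $v$ off and insert it into $C_w$ so that $v$ becomes the parent of $\mathsf{rft}(v)$ (i.e. $v$ becomes the left child of $w$ and $\mathsf{rft}(v)$ the right child of $v$); (c) if $\mathsf{rft}(v)$ does not exist, cut $v$ off and attach it as the right child of the last node of the right arm. If the right leaves of $T$ are $v_1<\cdots<v_m$, then $\Theta(T)=\theta_{v_m}\circ\cdots\circ\theta_{v_1}(T)$, each step applied to the tree resulting from the previous steps. -}

module Defs where

open import Data.Nat using (ℕ; zero; suc; _<_; _⊔_; _⊓_; _≡ᵇ_; _<ᵇ_)
open import Data.Nat.Properties using (≤-decTotalOrder)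
open import Data.Bool using (Bool; true; false; if_then_else_)
open import Data.List using (List; []; _∷_; _++_; [_]; foldr; foldl; length)
open import Data.Bool.ListAction using (any)
open import Data.List.Relation.Unary.All using (All)
open import Data.List.Relation.Binary.Sublist.Propositional using (_⊆_)
open import Data.Maybe using (Maybe; just; nothing)
open import Data.Product using (_×_; _,_; ∃; ∃-syntax)
open import Relation.Nullary using (¬_)
open import Relation.Binary.PropositionalEquality using (_≡_; _≢_)
import Data.List.Sort.InsertionSort as Sort

-- Words / permutations (one-line notation as lists of naturals)

Avoids321 : List ℕ → Set
Avoids321 π = ∀ a b c → (a ∷ b ∷ c ∷ []) ⊆ π → ¬ (c < b × b < a)

splitAt∈ : ℕ → List ℕ → List ℕ × List ℕ
splitAt∈ m [] = [] , []
splitAt∈ m (x ∷ xs) with x ≡ᵇ m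
... | true  = [] , xs
... | false with splitAt∈ m xs
...   | α , β = x ∷ α , β

-- Stack-sorting map S(∅)=∅, S(α m β) = S(α) S(β) m, m the largest letter.
-- (The first argument is fuel; length of the word suffices.)
stackSortF : ℕ → List ℕ → List ℕ
stackSortF _ [] = []
stackSortF zero (_ ∷ _) = []
stackSortF (suc k) (x ∷ xs) with foldr _⊔_ x xs
... | m with splitAt∈ m (x ∷ xs)
...   | α , β = stackSortF k α ++ stackSortF k β ++ [ m ]

stackSort : List ℕ → List ℕ
stackSort w = stackSortF (length w) w

data Tree : Set where
  leaf : Tree
  node : Tree → ℕ → Tree → Tree

toTreeF : ℕ → List ℕ → Tree
toTreeF _ [] = leaf
toTreeF zero (_ ∷ _) = leaf
toTreeF (suc k) (x ∷ xs) with foldr _⊓_ x xs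
... | i with splitAt∈ i (x ∷ xs)
...   | σ , τ = node (toTreeF k σ) i (toTreeF k τ)

λt : List ℕ → Tree
λt w = toTreeF (length w) w

-- λ⁻¹ : in-order reading of the labels
inorder : Tree → List ℕ
inorder leaf = []
inorder (node l x r) = inorder l ++ x ∷ inorder r

Increasing : Tree → Set
Increasing leaf = Data.Unit.⊤ where import Data.Unit
Increasing (node l x r) =
  All (x <_) (inorder l) × All (x <_) (inorder r) × Increasing l × Increasing r

-- Positions (paths from the root)

data Dir : Set where
  L R : Dir

-- subtree rooted at a path (leaf if the path leaves the tree)
at : List Dir → Tree → Tree
at [] t = t
at (_ ∷ _) leaf = leaf
at (L ∷ p) (node l _ _) = at p l
at (R ∷ p) (node _ _ r) = at p r

numL : List Dir → ℕ
numL [] = 0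
numL (L ∷ p) = suc (numL p)
numL (R ∷ p) = numL p

OnRightArm : List Dir → Set
OnRightArm p = All (_≡ R) p

rightArm : Tree → List ℕ
rightArm leaf = []
rightArm (node _ x r) = x ∷ rightArm r

IsRightLeaf : Tree → List Dir → Set
IsRightLeaf T p = ¬ OnRightArm p × ∃[ l ] ∃[ x ] (at p T ≡ node l x leaf)

ChainAt : Tree → List Dir → ℕ → List ℕ → Set
ChainAt T p v C = ∃[ l ] ∃[ r ] (at p T ≡ node l v r × l ≢ leaf × C ≡ rightArm l)

_≺_ : List ℕ → List ℕ → Set
C ≺ D = All (λ a → All (a <_) D) C

Is321Tree : Tree → Set
Is321Tree T =
  Increasing T
  × (∀ p → IsRightLeaf T p → numL p ≡ 1)
  × (∀ p q v w Cv Cw → ChainAt T p v Cv → ChainAt T q w Cw →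
       (Cv ≺ Cw → v < w) × (v < w → Cv ≺ Cw))

elem : ℕ → List ℕ → Bool
elem v = any (v ≡ᵇ_)

firstAbove : ℕ → List ℕ → Maybe ℕ
firstAbove v [] = nothing
firstAbove v (x ∷ xs) = if v <ᵇ x then just x else firstAbove v xs

rft : ℕ → Tree → Maybe ℕ
rft v leaf = nothing
rft v (node l x r) = if elem v (inorder l) then firstAbove v (inorder r) else rft v r

-- cut off the (leaf) node labelled v
cut : ℕ → Tree → Tree
cut v leaf = leaf
cut v (node l x r) = if x ≡ᵇ v then leaf else node (cut v l) x (cut v r)

insAbove : ℕ → ℕ → Tree → Tree
insAbove v u leaf = leaf
insAbove v u (node l x r) =
  if x ≡ᵇ u then node leaf v (node l x r) else node (insAbove v u l) x (insAbove v u r)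

appendRA : ℕ → Tree → Tree
appendRA v leaf = node leaf v leaf
appendRA v (node l x r) = node l x (appendRA v r)

-- θ_v : cases (a) and (b) are both "v becomes the parent of rft(v)"; case (c) appends
θ : ℕ → Tree → Tree
θ v T with rft v T
... | just u  = insAbove v u (cut v T)
... | nothing = appendRA v (cut v T)

noRAleaves : Tree → List ℕ   -- all nodes without right child (subtree off the right arm)
noRAleaves leaf = []
noRAleaves (node l x leaf) = noRAleaves l ++ [ x ]
noRAleaves (node l x r@(node _ _ _)) = noRAleaves l ++ noRAleaves r

rightLeaves : Tree → List ℕ
rightLeaves leaf = []
rightLeaves (node l x r) = noRAleaves l ++ rightLeaves r

open Sort ≤-decTotalOrder using (sort)

Θ : Tree → Tree
Θ T = foldl (λ S v → θ v S) T (sort (rightLeaves T))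

-- For π avoiding 321, λ(π) is a comb: its right arm m₁ < m₂ < ⋯ carries left subtrees that are
-- right chains c₁, c₂, …, each chain lies above its spine label, and the chains increase from left
-- to right.  Such a tree is a 321-avoiding tree whose right leaves are the chain ends, already in
-- increasing order.  Stack sorting is run as a stack machine.  On the comb word c v m W, where c v
-- is the first chain, the machine outputs c m and then behaves as on W with v inserted before its
-- first larger letter; θ_v makes the same move in the tree, as v becomes the parent of that letter.
-- Induction along the right arm therefore shows that Θ assembles exactly the output of the machine.

module Submission where

open import Defs
open import Data.Bool using (true; false; if_then_else_)
open import Data.Bool.Properties using (∨-zeroʳ)
open import Data.Empty using (⊥-elim)
open import Data.List
  using (List; []; _∷_; _++_; [_]; _∷ʳ_; foldr; foldl; length; map; upTo; takeWhile; dropWhile; initLast; _∷ʳ′_)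
open import Data.List.Properties using (++-assoc; length-++; takeWhile++dropWhile; foldr-preservesᵇ)
open import Data.List.Membership.Propositional using (_∈_; _∉_)
open import Data.List.Membership.Propositional.Properties using (∈-∃++; ∈-++⁺ˡ; ∈-++⁺ʳ; ∈-++⁻)
open import Data.List.Relation.Binary.Permutation.Propositional
  using (_↭_; ↭⇒↭ₛ; ↭-refl; ↭-prep; ↭-swap; ↭-trans; ↭-sym; module PermutationReasoning)
open import Data.List.Relation.Binary.Permutation.Propositional.Properties using (++⁺ˡ; ↭-length)
import Data.List.Relation.Binary.Permutation.Setoid.Properties as PermutationSetoid
open import Data.List.Relation.Binary.Sublist.Propositional using (_⊆_; _∷_; ⊆-refl; ⊆-trans; from∈; minimum)
import Data.List.Relation.Binary.Sublist.Propositional as Sublist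
import Data.List.Relation.Binary.Sublist.Propositional.Properties as Sublistₚ
open import Data.List.Relation.Unary.All using (All; []; _∷_)
import Data.List.Relation.Unary.All as All
import Data.List.Relation.Unary.All.Properties as Allₚ
open import Data.List.Relation.Unary.AllPairs using (AllPairs; []; _∷_)
import Data.List.Relation.Unary.AllPairs.Properties as AllPairsₚ
open import Data.List.Relation.Unary.Any using (here; there)
open import Data.List.Relation.Unary.Unique.Propositional using (Unique)
open import Data.List.Relation.Unary.Unique.Propositional.Properties using (Unique[x∷xs]⇒x∉xs; map⁺; upTo⁺)
open import Data.Maybe using (Maybe; just; nothing)
open import Data.Nat using (ℕ; zero; suc; _+_; _<_; _≤_; _⊔_; _⊓_; _≡ᵇ_; _<ᵇ_; _≟_; _<?_; _≤?_; s≤s⁻¹)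
open import Data.Nat.Properties
  using ( ≤-refl; ≤-trans; <-trans; <-asym; <-irrefl; <-cmp; <⇒≤; ≤∧≢⇒<; +-suc; m≤m+n; m≤n+m
        ; suc-injective; ⊔-sel; ⊓-sel; m≤m⊔n; m≤n⇒m≤o⊔n; m⊓n≤m; m≤n⇒o⊓m≤n; m≥n⇒m⊓n≡n; ≤-decTotalOrder)
open import Data.Product using (_×_; _,_; proj₁; proj₂; ∃-syntax; ∃₂)
open import Data.Sum using (_⊎_; inj₁; inj₂; [_,_]′)
open import Data.Unit using (tt)
open import Function using (_∘_)
open import Relation.Binary.Definitions using (tri<; tri≈; tri>)
open import Relation.Binary.PropositionalEquality hiding ([_])
open import Relation.Nullary using (¬_; does)
open import Relation.Nullary.Decidable using (dec-true; dec-false)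
open import Relation.Unary using (Decidable)
open import Data.List.Sort.InsertionSort ≤-decTotalOrder using (sort; insert)

≡ᵇ-true : ∀ {m n} → m ≡ n → (m ≡ᵇ n) ≡ true
≡ᵇ-true {m} {n} = dec-true (m ≟ n)

≡ᵇ-false : ∀ {m n} → m ≢ n → (m ≡ᵇ n) ≡ false
≡ᵇ-false {m} {n} = dec-false (m ≟ n)

<ᵇ-true : ∀ {m n} → m < n → (m <ᵇ n) ≡ true
<ᵇ-true {m} {n} = dec-true (m <? n)

<ᵇ-false : ∀ {m n} → ¬ m < n → (m <ᵇ n) ≡ false
<ᵇ-false {m} {n} = dec-false (m <? n)

module _ {A : Set} {P : A → Set} (P? : Decidable P) where

  takeWhile-all : ∀ {xs} → All P xs → takeWhile P? xs ≡ xs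
  takeWhile-all [] = refl
  takeWhile-all {x ∷ _} (px ∷ pxs) rewrite dec-true (P? x) px = cong (x ∷_) (takeWhile-all pxs)

  dropWhile-all : ∀ {xs} → All P xs → dropWhile P? xs ≡ []
  dropWhile-all [] = refl
  dropWhile-all {x ∷ _} (px ∷ pxs) rewrite dec-true (P? x) px = dropWhile-all pxs

  takeWhile-++-¬ : ∀ xs {y ys} → ¬ P y → takeWhile P? (xs ++ y ∷ ys) ≡ takeWhile P? xs
  takeWhile-++-¬ [] {y} ¬py rewrite dec-false (P? y) ¬py = refl
  takeWhile-++-¬ (x ∷ xs) ¬py with does (P? x)
  ... | true  = cong (x ∷_) (takeWhile-++-¬ xs ¬py)
  ... | false = refl

  dropWhile-++-¬ : ∀ xs {y ys} → ¬ P y → dropWhile P? (xs ++ y ∷ ys) ≡ dropWhile P? xs ++ y ∷ ys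
  dropWhile-++-¬ [] {y} ¬py rewrite dec-false (P? y) ¬py = refl
  dropWhile-++-¬ (x ∷ xs) ¬py with does (P? x)
  ... | true  = dropWhile-++-¬ xs ¬py
  ... | false = refl

  All-dropWhile : ∀ {Q : A → Set} {xs} → All Q xs → All Q (dropWhile P? xs)
  All-dropWhile {Q} {xs} qs =
    Allₚ.++⁻ʳ (takeWhile P? xs) (subst (All Q) (sym (takeWhile++dropWhile P? xs)) qs)

Unique-++⁻ˡ : ∀ {A : Set} (xs : List A) {ys} → Unique (xs ++ ys) → Unique xs
Unique-++⁻ˡ [] _ = []
Unique-++⁻ˡ (x ∷ xs) (x∉ ∷ u) = Allₚ.++⁻ˡ xs x∉ ∷ Unique-++⁻ˡ xs u

Unique-++⁻ʳ : ∀ {A : Set} (xs : List A) {ys} → Unique (xs ++ ys) → Unique ys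
Unique-++⁻ʳ [] u = u
Unique-++⁻ʳ (x ∷ xs) (_ ∷ u) = Unique-++⁻ʳ xs u

Unique-++-disjoint : ∀ {A : Set} (xs : List A) {ys a b} → Unique (xs ++ ys) → a ∈ xs → b ∈ ys → a ≢ b
Unique-++-disjoint (x ∷ xs) (x∉ ∷ _) (here refl) b∈ = All.lookup (Allₚ.++⁻ʳ xs x∉) b∈
Unique-++-disjoint (x ∷ xs) (_ ∷ u) (there a∈) b∈ = Unique-++-disjoint xs u a∈ b∈

Unique-++-∷⁻ : ∀ {A : Set} α {m : A} {β} → Unique (α ++ m ∷ β) →
  m ∉ α × m ∉ β × Unique α × Unique β
Unique-++-∷⁻ α u with Unique-++⁻ʳ α u
... | m∉β ∷ uβ =
  (λ m∈α → Unique-++-disjoint α u m∈α (here refl) refl) , Unique[x∷xs]⇒x∉xs (m∉β ∷ uβ) , Unique-++⁻ˡ α u , uβ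

Unique-resp-↭ : ∀ {A : Set} {xs ys : List A} → xs ↭ ys → Unique xs → Unique ys
Unique-resp-↭ {A} xs↭ys = PermutationSetoid.Unique-resp-↭ (setoid A) (↭⇒↭ₛ xs↭ys)

module _ {A : Set} {f : A → A → A} where
  open import Algebra.Definitions {A = A} _≡_ using (Selective)

  foldr-selective-∈ : Selective f → ∀ x xs → foldr f x xs ∈ x ∷ xs
  foldr-selective-∈ sel x xs = foldr-preservesᵇ pick (here refl) (All.tabulate there)
    where
    pick : ∀ {a b} → a ∈ x ∷ xs → b ∈ x ∷ xs → f a b ∈ x ∷ xs
    pick {a} {b} a∈ b∈ =
      [ (λ e → subst (_∈ x ∷ xs) (sym e) a∈) , (λ e → subst (_∈ x ∷ xs) (sym e) b∈) ]′ (sel a b)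

foldr-⊔-upper : ∀ x xs → All (_≤ foldr _⊔_ x xs) (x ∷ xs)
foldr-⊔-upper x [] = ≤-refl ∷ []
foldr-⊔-upper x (y ∷ ys) with foldr-⊔-upper x ys
... | x≤ ∷ ys≤ = m≤n⇒m≤o⊔n y x≤ ∷ m≤m⊔n y _ ∷ All.map (m≤n⇒m≤o⊔n y) ys≤

foldr-⊓-lower : ∀ x xs → All (foldr _⊓_ x xs ≤_) (x ∷ xs)
foldr-⊓-lower x [] = ≤-refl ∷ []
foldr-⊓-lower x (y ∷ ys) with foldr-⊓-lower x ys
... | ≤x ∷ ≤ys = m≤n⇒o⊓m≤n y ≤x ∷ m⊓n≤m y _ ∷ All.map (m≤n⇒o⊓m≤n y) ≤ys

foldr-⊓-head : ∀ a xs → All (a ≤_) xs → foldr _⊓_ a xs ≡ a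
foldr-⊓-head a [] _ = refl
foldr-⊓-head a (y ∷ ys) (a≤y ∷ a≤ys) rewrite foldr-⊓-head a ys a≤ys = m≥n⇒m⊓n≡n a≤y

All-≤∧∉⇒< : ∀ {m xs} → All (_≤ m) xs → m ∉ xs → All (_< m) xs
All-≤∧∉⇒< ≤m m∉ = All.tabulate λ a∈ → ≤∧≢⇒< (All.lookup ≤m a∈) λ { refl → m∉ a∈ }

All-≥∧∉⇒> : ∀ {m xs} → All (m ≤_) xs → m ∉ xs → All (m <_) xs
All-≥∧∉⇒> m≤ m∉ = All.tabulate λ a∈ → ≤∧≢⇒< (All.lookup m≤ a∈) λ { refl → m∉ a∈ }

length-++-∷ : ∀ α (m : ℕ) β → length (α ++ m ∷ β) ≡ suc (length α + length β)
length-++-∷ α m β = trans (length-++ α) (+-suc (length α) (length β))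

length-split-≤ : ∀ {k} α (m : ℕ) β → length (α ++ m ∷ β) ≤ suc k → length α ≤ k × length β ≤ k
length-split-≤ α m β len with s≤s⁻¹ (subst (_≤ _) (length-++-∷ α m β) len)
... | len′ = ≤-trans (m≤m+n (length α) (length β)) len′ , ≤-trans (m≤n+m (length β) (length α)) len′

insertBeforeAbove : ℕ → List ℕ → List ℕ
insertBeforeAbove v [] = [ v ]
insertBeforeAbove v (x ∷ xs) = if v <ᵇ x then v ∷ x ∷ xs else x ∷ insertBeforeAbove v xs

All-insertBeforeAbove : ∀ {P : ℕ → Set} v xs → P v → All P xs → All P (insertBeforeAbove v xs)
All-insertBeforeAbove v [] pv [] = pv ∷ []
All-insertBeforeAbove v (x ∷ xs) pv (px ∷ pxs) with v <ᵇ x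
... | true  = pv ∷ px ∷ pxs
... | false = px ∷ All-insertBeforeAbove v xs pv pxs

insertBeforeAbove-↭ : ∀ v xs → insertBeforeAbove v xs ↭ v ∷ xs
insertBeforeAbove-↭ v [] = ↭-refl
insertBeforeAbove-↭ v (x ∷ xs) with v <ᵇ x
... | true = ↭-refl
... | false = ↭-trans (↭-prep x (insertBeforeAbove-↭ v xs)) (↭-swap x v ↭-refl)

insert-below : ∀ x xs → All (x <_) xs → insert x xs ≡ x ∷ xs
insert-below x [] _ = refl
insert-below x (y ∷ ys) (x<y ∷ _) rewrite dec-true (x ≤? y) (<⇒≤ x<y) = refl

sort-ascending : ∀ xs → AllPairs _<_ xs → sort xs ≡ xs
sort-ascending [] _ = refl
sort-ascending (x ∷ xs) (x<xs ∷ asc) rewrite sort-ascending xs asc = insert-below x xs x<xs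

Avoids321-⊆ : ∀ {xs ys} → xs ⊆ ys → Avoids321 ys → Avoids321 xs
Avoids321-⊆ xs⊆ys av a b c abc⊆xs = av a b c (⊆-trans abc⊆xs xs⊆ys)

ascending-before-smaller : ∀ {i} σ → Unique σ → All (i <_) σ → Avoids321 (σ ∷ʳ i) → AllPairs _<_ σ
ascending-before-smaller [] _ _ _ = []
ascending-before-smaller {i} (a ∷ σ) (a∉σ ∷ u) (_ ∷ i<σ) av =
  All.tabulate a<b ∷ ascending-before-smaller σ u i<σ (Avoids321-⊆ (Sublistₚ.++⁺ˡ [ a ] ⊆-refl) av)
  where
  a<b : ∀ {b} → b ∈ σ → a < b
  a<b {b} b∈σ with <-cmp a b
  ... | tri< a<b _ _ = a<b
  ... | tri≈ _ a≡b _ = ⊥-elim (All.lookup a∉σ b∈σ a≡b)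
  ... | tri> _ _ b<a =
    ⊥-elim (av a b i (refl ∷ Sublistₚ.++⁺ (from∈ b∈σ) ⊆-refl) (All.lookup i<σ b∈σ , b<a))

splitAt∈-++ : ∀ {m} α β → m ∉ α → splitAt∈ m (α ++ m ∷ β) ≡ (α , β)
splitAt∈-++ {m} [] β _ rewrite ≡ᵇ-true (refl {x = m}) = refl
splitAt∈-++ {m} (x ∷ α) β m∉
  rewrite ≡ᵇ-false (λ x≡m → m∉ (here (sym x≡m))) | splitAt∈-++ α β (m∉ ∘ there) = refl

splitAt∈-unique : ∀ {m w} → Unique w → m ∈ w →
  ∃₂ λ α β → w ≡ α ++ m ∷ β × splitAt∈ m w ≡ (α , β)
splitAt∈-unique u m∈ with ∈-∃++ m∈
... | α , β , refl = α , β , refl , splitAt∈-++ α β (proj₁ (Unique-++-∷⁻ α u))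

-- Stack sorting as a stack machine

-- The stack is listed top first; before x is pushed, the run of entries smaller than x on top of it is output.
stackRun : List ℕ → List ℕ → List ℕ
stackRun stack [] = stack
stackRun stack (x ∷ xs) = takeWhile (_<? x) stack ++ stackRun (x ∷ dropWhile (_<? x) stack) xs

stackRun-push-above : ∀ st x w → All (_< x) st → stackRun st (x ∷ w) ≡ st ++ stackRun [ x ] w
stackRun-push-above st x w st<x =
  cong₂ (λ popped rest → popped ++ stackRun (x ∷ rest) w)
        (takeWhile-all (_<? x) st<x) (dropWhile-all (_<? x) st<x)

stackRun-push-below : ∀ y st x w → x < y → stackRun (y ∷ st) (x ∷ w) ≡ stackRun (x ∷ y ∷ st) w
stackRun-push-below y st x w x<y =
  cong₂ (λ popped rest → popped ++ stackRun (x ∷ rest) w)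
        (takeWhile-++-¬ (_<? x) [] y≮x) (dropWhile-++-¬ (_<? x) [] y≮x)
  where
  y≮x = <-asym x<y

stackRun-max : ∀ st α m β → All (_< m) st → All (_< m) α →
  stackRun st (α ++ m ∷ β) ≡ stackRun st α ++ stackRun [ m ] β
stackRun-max st [] m β st<m [] = stackRun-push-above st m β st<m
stackRun-max st (x ∷ α) m β st<m (x<m ∷ α<m) = begin
  popped ++ stackRun (x ∷ rest) (α ++ m ∷ β)
    ≡⟨ cong (popped ++_) (stackRun-max (x ∷ rest) α m β (x<m ∷ All-dropWhile (_<? x) st<m) α<m) ⟩
  popped ++ (stackRun (x ∷ rest) α ++ stackRun [ m ] β)
    ≡⟨ ++-assoc popped _ _ ⟨
  (popped ++ stackRun (x ∷ rest) α) ++ stackRun [ m ] β ∎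
  where
  open ≡-Reasoning
  popped = takeWhile (_<? x) st
  rest = dropWhile (_<? x) st

stackRun-bottom : ∀ st β M → All (_< M) st → All (_< M) β → stackRun (st ∷ʳ M) β ≡ stackRun st β ∷ʳ M
stackRun-bottom st [] M _ _ = refl
stackRun-bottom st (x ∷ β) M st<M (x<M ∷ β<M) = begin
  takeWhile (_<? x) (st ∷ʳ M) ++ stackRun (x ∷ dropWhile (_<? x) (st ∷ʳ M)) β
    ≡⟨ cong₂ (λ popped rest → popped ++ stackRun (x ∷ rest) β)
             (takeWhile-++-¬ (_<? x) st M≮x) (dropWhile-++-¬ (_<? x) st M≮x) ⟩
  popped ++ stackRun ((x ∷ rest) ∷ʳ M) β
    ≡⟨ cong (popped ++_) (stackRun-bottom (x ∷ rest) β M (x<M ∷ All-dropWhile (_<? x) st<M) β<M) ⟩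
  popped ++ (stackRun (x ∷ rest) β ∷ʳ M)
    ≡⟨ ++-assoc popped _ _ ⟨
  (popped ++ stackRun (x ∷ rest) β) ∷ʳ M ∎
  where
  open ≡-Reasoning
  M≮x = <-asym x<M
  popped = takeWhile (_<? x) st
  rest = dropWhile (_<? x) st

stackRun-bottom-insert : ∀ st v w → All (_< v) st → v ∉ w →
  stackRun (st ∷ʳ v) w ≡ stackRun st (insertBeforeAbove v w)
stackRun-bottom-insert st v [] st<v _ = sym (stackRun-push-above st v [] st<v)
stackRun-bottom-insert st v (x ∷ w) st<v v∉ with <-cmp v x
... | tri< v<x _ _ rewrite <ᵇ-true v<x = begin
  stackRun (st ∷ʳ v) (x ∷ w)
    ≡⟨ stackRun-push-above (st ∷ʳ v) x w (Allₚ.∷ʳ⁺ (All.map (λ y<v → <-trans y<v v<x) st<v) v<x) ⟩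
  (st ∷ʳ v) ++ stackRun [ x ] w
    ≡⟨ ++-assoc st [ v ] _ ⟩
  st ++ [ v ] ++ stackRun [ x ] w
    ≡⟨ cong (st ++_) (stackRun-push-above [ v ] x w (v<x ∷ [])) ⟨
  st ++ stackRun [ v ] (x ∷ w)
    ≡⟨ stackRun-push-above st v (x ∷ w) st<v ⟨
  stackRun st (v ∷ x ∷ w) ∎
  where open ≡-Reasoning
... | tri≈ _ v≡x _ = ⊥-elim (v∉ (here v≡x))
... | tri> v≮x _ x<v rewrite <ᵇ-false v≮x = begin
  takeWhile (_<? x) (st ∷ʳ v) ++ stackRun (x ∷ dropWhile (_<? x) (st ∷ʳ v)) w
    ≡⟨ cong₂ (λ popped rest → popped ++ stackRun (x ∷ rest) w)
             (takeWhile-++-¬ (_<? x) st v≮x) (dropWhile-++-¬ (_<? x) st v≮x) ⟩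
  popped ++ stackRun ((x ∷ rest) ∷ʳ v) w
    ≡⟨ cong (popped ++_)
            (stackRun-bottom-insert (x ∷ rest) v w (x<v ∷ All-dropWhile (_<? x) st<v) (v∉ ∘ there)) ⟩
  popped ++ stackRun (x ∷ rest) (insertBeforeAbove v w) ∎
  where
  open ≡-Reasoning
  popped = takeWhile (_<? x) st
  rest = dropWhile (_<? x) st

stackRun-singleton-min : ∀ m w → All (m <_) w → stackRun [ m ] w ≡ m ∷ stackRun [] w
stackRun-singleton-min m [] _ = refl
stackRun-singleton-min m (y ∷ w) (m<y ∷ _) = stackRun-push-above [ m ] y w (m<y ∷ [])

stackRun-ascending : ∀ c v r → AllPairs _<_ (c ∷ʳ v) → stackRun [] ((c ∷ʳ v) ++ r) ≡ c ++ stackRun [ v ] r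
stackRun-ascending [] v r _ = refl
stackRun-ascending (y ∷ c) v r asc = go y c asc
  where
  go : ∀ y c → AllPairs _<_ (y ∷ c ∷ʳ v) → stackRun [ y ] ((c ∷ʳ v) ++ r) ≡ y ∷ c ++ stackRun [ v ] r
  go y [] ((y<v ∷ []) ∷ _) = stackRun-push-above [ y ] v r (y<v ∷ [])
  go y (x ∷ c) ((y<x ∷ _) ∷ asc) =
    trans (stackRun-push-above [ y ] x ((c ∷ʳ v) ++ r) (y<x ∷ [])) (cong (y ∷_) (go x c asc))

stackRun-chain-spine : ∀ c v m w → AllPairs _<_ (c ∷ʳ v) → m < v → All (m <_) w → v ∉ w →
  stackRun [] ((c ∷ʳ v) ++ m ∷ w) ≡ c ++ m ∷ stackRun [] (insertBeforeAbove v w)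
stackRun-chain-spine c v m w asc m<v m<w v∉w = begin
  stackRun [] ((c ∷ʳ v) ++ m ∷ w)
    ≡⟨ stackRun-ascending c v (m ∷ w) asc ⟩
  c ++ stackRun [ v ] (m ∷ w)
    ≡⟨ cong (c ++_) (stackRun-push-below v [] m w m<v) ⟩
  c ++ stackRun ([ m ] ∷ʳ v) w
    ≡⟨ cong (c ++_) (stackRun-bottom-insert [ m ] v w (m<v ∷ []) v∉w) ⟩
  c ++ stackRun [ m ] (insertBeforeAbove v w)
    ≡⟨ cong (c ++_) (stackRun-singleton-min m _ (All-insertBeforeAbove v w m<v m<w)) ⟩
  c ++ m ∷ stackRun [] (insertBeforeAbove v w) ∎
  where open ≡-Reasoning

stackSortF-split : ∀ k x xs {α β} → splitAt∈ (foldr _⊔_ x xs) (x ∷ xs) ≡ (α , β) →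
  stackSortF (suc k) (x ∷ xs) ≡ stackSortF k α ++ stackSortF k β ++ [ foldr _⊔_ x xs ]
stackSortF-split k x xs split rewrite split = refl

stackSortF≗stackRun : ∀ k w → length w ≤ k → Unique w → stackSortF k w ≡ stackRun [] w
stackSortF≗stackRun k [] _ _ = refl
stackSortF≗stackRun (suc k) (x ∷ xs) len u with splitAt∈-unique u (foldr-selective-∈ ⊔-sel x xs)
... | α , β , eq , split with Unique-++-∷⁻ α (subst Unique eq u)
...   | m∉α , m∉β , uα , uβ = begin
  stackSortF (suc k) (x ∷ xs)                ≡⟨ stackSortF-split k x xs split ⟩
  stackSortF k α ++ stackSortF k β ++ [ m ]  ≡⟨ cong₂ (λ sα sβ → sα ++ sβ ++ [ m ])
                                                     (stackSortF≗stackRun k α lenα uα)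
                                                     (stackSortF≗stackRun k β lenβ uβ) ⟩
  stackRun [] α ++ stackRun [] β ∷ʳ m        ≡⟨ cong (stackRun [] α ++_) (stackRun-bottom [] β m [] β<m) ⟨
  stackRun [] α ++ stackRun [ m ] β          ≡⟨ stackRun-max [] α m β [] α<m ⟨
  stackRun [] (α ++ m ∷ β)                   ≡⟨ cong (stackRun []) eq ⟨
  stackRun [] (x ∷ xs)                       ∎
  where
  open ≡-Reasoning
  m = foldr _⊔_ x xs
  ≤m = subst (All (_≤ m)) eq (foldr-⊔-upper x xs)
  α<m = All-≤∧∉⇒< (Allₚ.++⁻ˡ α ≤m) m∉α
  β<m = All-≤∧∉⇒< (All.tail (Allₚ.++⁻ʳ α ≤m)) m∉β
  lengths = length-split-≤ α m β (subst (λ w → length w ≤ suc k) eq len)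
  lenα = proj₁ lengths
  lenβ = proj₂ lengths

-- Combs

-- The comb (c₁ , m₁) ∷ (c₂ , m₂) ∷ ⋯ is the tree with right arm m₁ m₂ ⋯ whose left subtree at mᵢ
-- is the right chain cᵢ.
Block : Set
Block = List ℕ × ℕ

chainTree : List ℕ → Tree
chainTree [] = leaf
chainTree (x ∷ xs) = node leaf x (chainTree xs)

combTree : List Block → Tree
combTree [] = leaf
combTree ((c , m) ∷ B) = node (chainTree c) m (combTree B)

combWord : List Block → List ℕ
combWord [] = []
combWord ((c , m) ∷ B) = c ++ m ∷ combWord B

chainLabels : List Block → List ℕ
chainLabels [] = []
chainLabels ((c , _) ∷ B) = c ++ chainLabels B

chainEnd : List ℕ → List ℕ
chainEnd [] = []
chainEnd (x ∷ []) = [ x ]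
chainEnd (_ ∷ y ∷ c) = chainEnd (y ∷ c)

chainEnds : List Block → List ℕ
chainEnds [] = []
chainEnds ((c , _) ∷ B) = chainEnd c ++ chainEnds B

data CombWith (SpineBelow : ℕ → List ℕ → Set) : List Block → Set where
  [] : CombWith SpineBelow []
  block : ∀ {c m B} → AllPairs _<_ c → SpineBelow m c → All (m <_) (combWord B) → c ≺ chainLabels B →
          CombWith SpineBelow B → CombWith SpineBelow ((c , m) ∷ B)

IncreasingComb : List Block → Set
IncreasingComb = CombWith (λ m c → All (m <_) c)

-- Θ moves chain ends to the front of later chains, so only the end of a chain stays above its spine label.
Comb : List Block → Set
Comb = CombWith (λ m c → All (m <_) (chainEnd c))

inorder-chainTree : ∀ c → inorder (chainTree c) ≡ c
inorder-chainTree [] = refl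
inorder-chainTree (x ∷ c) = cong (x ∷_) (inorder-chainTree c)

inorder-combTree : ∀ B → inorder (combTree B) ≡ combWord B
inorder-combTree [] = refl
inorder-combTree ((c , m) ∷ B) = cong₂ (λ l r → l ++ m ∷ r) (inorder-chainTree c) (inorder-combTree B)

combWord-++ : ∀ P B → combWord (P ++ B) ≡ combWord P ++ combWord B
combWord-++ [] B = refl
combWord-++ ((c , m) ∷ P) B =
  trans (cong (λ w → c ++ m ∷ w) (combWord-++ P B)) (sym (++-assoc c (m ∷ combWord P) (combWord B)))

All-chainEnd : ∀ {P : ℕ → Set} c → All P c → All P (chainEnd c)
All-chainEnd [] _ = []
All-chainEnd (x ∷ []) (px ∷ _) = px ∷ []
All-chainEnd (x ∷ y ∷ c) (_ ∷ pc) = All-chainEnd (y ∷ c) pc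

chainEnd-∷ʳ : ∀ c v → chainEnd (c ∷ʳ v) ≡ [ v ]
chainEnd-∷ʳ [] v = refl
chainEnd-∷ʳ (x ∷ []) v = refl
chainEnd-∷ʳ (x ∷ y ∷ c) v = chainEnd-∷ʳ (y ∷ c) v

IncreasingComb⇒Comb : ∀ {B} → IncreasingComb B → Comb B
IncreasingComb⇒Comb [] = []
IncreasingComb⇒Comb (block {c} asc m<c m<B c≺B comb) =
  block asc (All-chainEnd c m<c) m<B c≺B (IncreasingComb⇒Comb comb)

-- λ of a 321-avoiding permutation

chainLabels-descent : ∀ {B y} → IncreasingComb B → y ∈ chainLabels B →
  ∃[ z ] (y ∷ z ∷ [] ⊆ combWord B × z < y)
chainLabels-descent {(c , m) ∷ B} (block _ m<c _ _ comb) y∈ with ∈-++⁻ c y∈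
... | inj₁ y∈c = m , Sublistₚ.++⁺ (from∈ y∈c) (refl ∷ minimum _) , All.lookup m<c y∈c
... | inj₂ y∈B with chainLabels-descent comb y∈B
...   | z , yz⊆ , z<y = z , Sublistₚ.++⁺ˡ c (Sublistₚ.++⁺ˡ [ m ] yz⊆) , z<y

prefix-below-chainLabels : ∀ σ {i B} → Unique (σ ++ i ∷ combWord B) → Avoids321 (σ ++ i ∷ combWord B) →
  IncreasingComb B → σ ≺ chainLabels B
prefix-below-chainLabels σ {i} {B} u av comb = All.tabulate λ a∈σ → All.tabulate λ y∈B → below a∈σ y∈B
  where
  below : ∀ {a y} → a ∈ σ → y ∈ chainLabels B → a < y
  below {a} {y} a∈σ y∈B with chainLabels-descent comb y∈B | <-cmp a y
  ... | _ | tri< a<y _ _ = a<y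
  ... | _ , yz⊆ , _ | tri≈ _ refl _ =
    ⊥-elim (Unique-++-disjoint σ u a∈σ (there (Sublist.lookup yz⊆ (here refl))) refl)
  ... | z , yz⊆ , z<y | tri> _ _ y<a =
    ⊥-elim (av a y z (Sublistₚ.++⁺ (from∈ a∈σ) (Sublistₚ.++⁺ˡ [ i ] yz⊆)) (z<y , y<a))

toTreeF-split : ∀ k x xs {σ τ} → splitAt∈ (foldr _⊓_ x xs) (x ∷ xs) ≡ (σ , τ) →
  toTreeF (suc k) (x ∷ xs) ≡ node (toTreeF k σ) (foldr _⊓_ x xs) (toTreeF k τ)
toTreeF-split k x xs split rewrite split = refl

toTreeF-ascending : ∀ k σ → length σ ≤ k → AllPairs _<_ σ → toTreeF k σ ≡ chainTree σ
toTreeF-ascending k [] _ _ = refl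
toTreeF-ascending (suc k) (a ∷ σ) len (a<σ ∷ asc) = begin
  toTreeF (suc k) (a ∷ σ)
    ≡⟨ toTreeF-split k a σ split ⟩
  node (toTreeF k []) (foldr _⊓_ a σ) (toTreeF k σ)
    ≡⟨ cong₂ (node leaf) min≡a (toTreeF-ascending k σ (s≤s⁻¹ len) asc) ⟩
  node leaf a (chainTree σ) ∎
  where
  open ≡-Reasoning
  min≡a = foldr-⊓-head a σ (All.map <⇒≤ a<σ)
  split : splitAt∈ (foldr _⊓_ a σ) (a ∷ σ) ≡ ([] , σ)
  split = subst (λ i → splitAt∈ i (a ∷ σ) ≡ ([] , σ)) (sym min≡a) (splitAt∈-++ [] σ λ ())

λt-comb : ∀ k w → length w ≤ k → Unique w → Avoids321 w →
  ∃[ B ] IncreasingComb B × combWord B ≡ w × toTreeF k w ≡ combTree B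
λt-comb k [] _ _ _ = [] , [] , refl , refl
λt-comb (suc k) (x ∷ xs) len u av with splitAt∈-unique u (foldr-selective-∈ ⊓-sel x xs)
... | σ , τ , eq , split
  with Unique-++-∷⁻ σ (subst Unique eq u) | length-split-≤ σ _ τ (subst (λ w → length w ≤ suc k) eq len)
...   | i∉σ , i∉τ , uσ , uτ | lenσ , lenτ
  with λt-comb k τ lenτ uτ
                (Avoids321-⊆ (Sublistₚ.++⁺ˡ σ (Sublistₚ.++⁺ˡ [ _ ] ⊆-refl)) (subst Avoids321 eq av))
...     | B , comb , refl , tree≡ =
  (σ , i) ∷ B , block ascσ i<σ i<B (prefix-below-chainLabels σ u′ av′ comb) comb , sym eq ,
  trans (toTreeF-split k x xs split) (cong₂ (λ l r → node l i r) (toTreeF-ascending k σ lenσ ascσ) tree≡)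
  where
  i = foldr _⊓_ x xs
  u′ = subst Unique eq u
  av′ = subst Avoids321 eq av
  i≤ = subst (All (i ≤_)) eq (foldr-⊓-lower x xs)
  i<σ = All-≥∧∉⇒> (Allₚ.++⁻ˡ σ i≤) i∉σ
  i<B = All-≥∧∉⇒> (All.tail (Allₚ.++⁻ʳ σ i≤)) i∉τ
  ascσ = ascending-before-smaller σ uσ i<σ (Avoids321-⊆ (Sublistₚ.++⁺ ⊆-refl (refl ∷ minimum _)) av′)

-- Increasing combs are 321-avoiding trees

Increasing-chainTree : ∀ c → AllPairs _<_ c → Increasing (chainTree c)
Increasing-chainTree [] _ = tt
Increasing-chainTree (x ∷ c) (x<c ∷ asc) =
  [] , subst (All (x <_)) (sym (inorder-chainTree c)) x<c , tt , Increasing-chainTree c asc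

Increasing-combTree : ∀ {B} → IncreasingComb B → Increasing (combTree B)
Increasing-combTree [] = tt
Increasing-combTree (block {c} {m} {B} asc m<c m<B _ comb) =
  subst (All (m <_)) (sym (inorder-chainTree c)) m<c , subst (All (m <_)) (sym (inorder-combTree B)) m<B ,
  Increasing-chainTree c asc , Increasing-combTree comb

at-chainTree : ∀ c q {l x r} → at q (chainTree c) ≡ node l x r → numL q ≡ 0 × l ≡ leaf
at-chainTree [] [] ()
at-chainTree [] (_ ∷ _) ()
at-chainTree (y ∷ c) [] refl = refl , refl
at-chainTree (y ∷ c) (L ∷ []) ()
at-chainTree (y ∷ c) (L ∷ _ ∷ _) ()
at-chainTree (y ∷ c) (R ∷ q) eq = at-chainTree c q eq

combTree-rightLeaf-numL : ∀ B p → IsRightLeaf (combTree B) p → numL p ≡ 1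
combTree-rightLeaf-numL [] [] (_ , _ , _ , ())
combTree-rightLeaf-numL [] (_ ∷ _) (_ , _ , _ , ())
combTree-rightLeaf-numL (_ ∷ _) [] (¬arm , _) = ⊥-elim (¬arm [])
combTree-rightLeaf-numL ((c , _) ∷ _) (L ∷ q) (_ , _ , _ , eq) = cong suc (proj₁ (at-chainTree c q eq))
combTree-rightLeaf-numL (_ ∷ B) (R ∷ q) (¬arm , leaf-at) =
  combTree-rightLeaf-numL B q (¬arm ∘ (refl ∷_) , leaf-at)

rightArm-chainTree : ∀ c → rightArm (chainTree c) ≡ c
rightArm-chainTree [] = refl
rightArm-chainTree (x ∷ c) = cong (x ∷_) (rightArm-chainTree c)

ChainAt-leaf : ∀ p {v C} → ¬ ChainAt leaf p v C
ChainAt-leaf [] (_ , _ , () , _)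
ChainAt-leaf (_ ∷ _) (_ , _ , () , _)

ChainAt-combTree : ∀ c m B p {v C} → ChainAt (combTree ((c , m) ∷ B)) p v C →
  (v ≡ m × C ≡ c × c ≢ []) ⊎ ∃[ p′ ] ChainAt (combTree B) p′ v C
ChainAt-combTree c m B [] (_ , _ , refl , l≢leaf , refl) =
  inj₁ (refl , rightArm-chainTree c , λ { refl → l≢leaf refl })
ChainAt-combTree c m B (L ∷ q) (_ , _ , eq , l≢leaf , _) = ⊥-elim (l≢leaf (proj₂ (at-chainTree c q eq)))
ChainAt-combTree c m B (R ∷ q) chain = inj₂ (q , chain)

ChainAt-combTree⁻ : ∀ B p {v C} → ChainAt (combTree B) p v C →
  v ∈ combWord B × All (_∈ chainLabels B) C × C ≢ []
ChainAt-combTree⁻ [] p chain = ⊥-elim (ChainAt-leaf p chain)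
ChainAt-combTree⁻ ((c , m) ∷ B) p chain with ChainAt-combTree c m B p chain
... | inj₁ (refl , refl , c≢[]) = ∈-++⁺ʳ c (here refl) , All.tabulate ∈-++⁺ˡ , c≢[]
... | inj₂ (p′ , chain′) with ChainAt-combTree⁻ B p′ chain′
...   | v∈ , C⊆ , C≢[] = ∈-++⁺ʳ c (there v∈) , All.map (∈-++⁺ʳ c) C⊆ , C≢[]

≺-irrefl : ∀ {C} → C ≢ [] → ¬ (C ≺ C)
≺-irrefl {[]} C≢[] _ = C≢[] refl
≺-irrefl {x ∷ _} _ (x<C ∷ _) = <-irrefl refl (All.lookup x<C (here refl))

≺-asym : ∀ {C D E} → C ≺ D → All (_∈ D) E → C ≢ [] → E ≢ [] → ¬ (E ≺ C)
≺-asym {[]} _ _ C≢[] _ _ = C≢[] refl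
≺-asym {_} {_} {[]} _ _ _ E≢[] _ = E≢[] refl
≺-asym {x ∷ _} {_} {y ∷ _} (x<D ∷ _) (y∈D ∷ _) _ _ (y<C ∷ _) =
  <-asym (All.lookup x<D y∈D) (All.lookup y<C (here refl))

combTree-chainOrder : ∀ {B} → IncreasingComb B → ∀ p q {v w Cv Cw} →
  ChainAt (combTree B) p v Cv → ChainAt (combTree B) q w Cw → (Cv ≺ Cw → v < w) × (v < w → Cv ≺ Cw)
combTree-chainOrder [] p q chv _ = ⊥-elim (ChainAt-leaf p chv)
combTree-chainOrder {(c , m) ∷ B} (block _ _ m<B c≺B comb) p q chv chw
  with ChainAt-combTree c m B p chv | ChainAt-combTree c m B q chw
... | inj₁ (refl , refl , c≢[]) | inj₁ (refl , refl , _) =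
  ⊥-elim ∘ ≺-irrefl c≢[] , ⊥-elim ∘ <-irrefl refl
... | inj₁ (refl , refl , _) | inj₂ (q′ , chw′) =
  let w∈ , Cw⊆ , _ = ChainAt-combTree⁻ B q′ chw′
  in (λ _ → All.lookup m<B w∈) , (λ _ → All.map (λ a<B → All.map (All.lookup a<B) Cw⊆) c≺B)
... | inj₂ (p′ , chv′) | inj₁ (refl , refl , c≢[]) =
  let v∈ , Cv⊆ , Cv≢[] = ChainAt-combTree⁻ B p′ chv′
  in ⊥-elim ∘ ≺-asym c≺B Cv⊆ c≢[] Cv≢[] , λ v<m → ⊥-elim (<-asym v<m (All.lookup m<B v∈))
... | inj₂ (p′ , chv′) | inj₂ (q′ , chw′) = combTree-chainOrder comb p′ q′ chv′ chw′

Is321Tree-combTree : ∀ {B} → IncreasingComb B → Is321Tree (combTree B)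
Is321Tree-combTree {B} comb =
  Increasing-combTree comb , combTree-rightLeaf-numL B , λ p q _ _ _ _ → combTree-chainOrder comb p q

noRAleaves-chainTree : ∀ c → noRAleaves (chainTree c) ≡ chainEnd c
noRAleaves-chainTree [] = refl
noRAleaves-chainTree (x ∷ []) = refl
noRAleaves-chainTree (x ∷ y ∷ c) = noRAleaves-chainTree (y ∷ c)

rightLeaves-combTree : ∀ B → rightLeaves (combTree B) ≡ chainEnds B
rightLeaves-combTree [] = refl
rightLeaves-combTree ((c , _) ∷ B) = cong₂ _++_ (noRAleaves-chainTree c) (rightLeaves-combTree B)

AllPairs-chainEnd : ∀ {R : ℕ → ℕ → Set} c → AllPairs R (chainEnd c)
AllPairs-chainEnd [] = []
AllPairs-chainEnd (x ∷ []) = [] ∷ []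
AllPairs-chainEnd (x ∷ y ∷ c) = AllPairs-chainEnd (y ∷ c)

All-chainEnds : ∀ {P : ℕ → Set} B → All P (chainLabels B) → All P (chainEnds B)
All-chainEnds [] _ = []
All-chainEnds ((c , _) ∷ B) pB =
  Allₚ.++⁺ (All-chainEnd c (Allₚ.++⁻ˡ c pB)) (All-chainEnds B (Allₚ.++⁻ʳ c pB))

chainEnds-ascending : ∀ {S B} → CombWith S B → AllPairs _<_ (chainEnds B)
chainEnds-ascending [] = []
chainEnds-ascending (block {c} {B = B} _ _ _ c≺B comb) =
  AllPairsₚ.++⁺ (AllPairs-chainEnd c) (chainEnds-ascending comb) (All-chainEnd c (All.map (All-chainEnds B) c≺B))

-- θ on combs

elem-∉ : ∀ {v} xs → v ∉ xs → elem v xs ≡ false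
elem-∉ [] _ = refl
elem-∉ (x ∷ xs) v∉ rewrite ≡ᵇ-false (v∉ ∘ here) = elem-∉ xs (v∉ ∘ there)

elem-∈ : ∀ {v xs} → v ∈ xs → elem v xs ≡ true
elem-∈ (here v≡x) rewrite ≡ᵇ-true v≡x = refl
elem-∈ {v} {x ∷ _} (there v∈) rewrite elem-∈ v∈ = ∨-zeroʳ (v ≡ᵇ x)

cut-∉ : ∀ {v} t → v ∉ inorder t → cut v t ≡ t
cut-∉ leaf _ = refl
cut-∉ (node l x r) v∉ rewrite ≡ᵇ-false (v∉ ∘ ∈-++⁺ʳ (inorder l) ∘ here ∘ sym)
  | cut-∉ l (v∉ ∘ ∈-++⁺ˡ) | cut-∉ r (v∉ ∘ ∈-++⁺ʳ (inorder l) ∘ there) = refl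

insAbove-∉ : ∀ {v u} t → u ∉ inorder t → insAbove v u t ≡ t
insAbove-∉ leaf _ = refl
insAbove-∉ {v} (node l x r) u∉ rewrite ≡ᵇ-false (u∉ ∘ ∈-++⁺ʳ (inorder l) ∘ here ∘ sym)
  | insAbove-∉ {v} l (u∉ ∘ ∈-++⁺ˡ) | insAbove-∉ {v} r (u∉ ∘ ∈-++⁺ʳ (inorder l) ∘ there) = refl

rft-node-∉ : ∀ {v} l x r → v ∉ inorder l → rft v (node l x r) ≡ rft v r
rft-node-∉ l x r v∉ rewrite elem-∉ (inorder l) v∉ = refl

rft-node-∈ : ∀ {v} l x r → v ∈ inorder l → rft v (node l x r) ≡ firstAbove v (inorder r)
rft-node-∈ l x r v∈ rewrite elem-∈ v∈ = refl

cut-node : ∀ {v} l x r → v ∉ inorder l → x ≢ v → cut v (node l x r) ≡ node l x (cut v r)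
cut-node l x r v∉ x≢v rewrite ≡ᵇ-false x≢v | cut-∉ l v∉ = refl

insAbove-node : ∀ {v u} l x r → u ∉ inorder l → x ≢ u →
  insAbove v u (node l x r) ≡ node l x (insAbove v u r)
insAbove-node {v} l x r u∉ x≢u rewrite ≡ᵇ-false x≢u | insAbove-∉ {v} l u∉ = refl

reinsert : ℕ → Maybe ℕ → Tree → Tree
reinsert v (just u) = insAbove v u
reinsert v nothing = appendRA v

θ-reinsert : ∀ v t → θ v t ≡ reinsert v (rft v t) (cut v t)
θ-reinsert v t with rft v t
... | just _ = refl
... | nothing = refl

reinsert-node : ∀ v mu l x r → (∀ {u} → mu ≡ just u → u ∉ inorder l × x ≢ u) →
  reinsert v mu (node l x r) ≡ node l x (reinsert v mu r)
reinsert-node v (just u) l x r avoids = insAbove-node l x r (proj₁ (avoids refl)) (proj₂ (avoids refl))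
reinsert-node v nothing l x r _ = refl

θ-node : ∀ {v} l x r → v ∉ inorder l → x ≢ v →
  (∀ {u} → rft v r ≡ just u → u ∉ inorder l × x ≢ u) →
  θ v (node l x r) ≡ node l x (θ v r)
θ-node {v} l x r v∉ x≢v avoids = begin
  θ v (node l x r)                               ≡⟨ θ-reinsert v (node l x r) ⟩
  reinsert v (rft v (node l x r)) (cut v (node l x r))
    ≡⟨ cong₂ (reinsert v) (rft-node-∉ l x r v∉) (cut-node l x r v∉ x≢v) ⟩
  reinsert v (rft v r) (node l x (cut v r))      ≡⟨ reinsert-node v (rft v r) l x (cut v r) avoids ⟩
  node l x (reinsert v (rft v r) (cut v r))      ≡⟨ cong (node l x) (θ-reinsert v r) ⟨
  node l x (θ v r)                               ∎
  where open ≡-Reasoning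

∉-chainTree : ∀ {v} c → v ∉ c → v ∉ inorder (chainTree c)
∉-chainTree c v∉ = v∉ ∘ subst (_ ∈_) (inorder-chainTree c)

rft-combTree-++ : ∀ {v} P B → v ∉ combWord P → rft v (combTree (P ++ B)) ≡ rft v (combTree B)
rft-combTree-++ [] B _ = refl
rft-combTree-++ ((c , m) ∷ P) B v∉ =
  trans (rft-node-∉ (chainTree c) m (combTree (P ++ B)) (∉-chainTree c (v∉ ∘ ∈-++⁺ˡ)))
        (rft-combTree-++ P B (v∉ ∘ ∈-++⁺ʳ c ∘ there))

θ-combTree-++ : ∀ {v} P {B B′} → v ∉ combWord P →
  (∀ {u} → rft v (combTree B) ≡ just u → u ∉ combWord P) →
  θ v (combTree B) ≡ combTree B′ → θ v (combTree (P ++ B)) ≡ combTree (P ++ B′)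
θ-combTree-++ [] _ _ θB≡ = θB≡
θ-combTree-++ {v} ((c , m) ∷ P) {B} v∉ rft∉ θB≡ =
  trans (θ-node (chainTree c) m (combTree (P ++ B))
                (∉-chainTree c (v∉ ∘ ∈-++⁺ˡ)) (v∉ ∘ ∈-++⁺ʳ c ∘ here ∘ sym) avoids)
        (cong (node (chainTree c) m)
              (θ-combTree-++ P (v∉ ∘ ∈-++⁺ʳ c ∘ there) (λ eq → rft∉ eq ∘ ∈-++⁺ʳ c ∘ there) θB≡))
  where
  avoids : ∀ {u} → rft v (combTree (P ++ B)) ≡ just u → u ∉ inorder (chainTree c) × m ≢ u
  avoids eq = let u∉ = rft∉ (trans (sym (rft-combTree-++ P B (v∉ ∘ ∈-++⁺ʳ c ∘ there))) eq)
              in ∉-chainTree c (u∉ ∘ ∈-++⁺ˡ) , u∉ ∘ ∈-++⁺ʳ c ∘ here ∘ sym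

-- Meant for v below every chain label, so that the first letter of the comb word above v is a
-- spine label or a chain head.
combInsert : ℕ → List Block → List Block
combInsert v [] = [ ([] , v) ]
combInsert v (([] , m) ∷ B) = if v <ᵇ m then ([] , v) ∷ ([] , m) ∷ B else ([] , m) ∷ combInsert v B
combInsert v ((y ∷ c , m) ∷ B) = (v ∷ y ∷ c , m) ∷ B

firstAbove-∈ : ∀ {v u} xs → firstAbove v xs ≡ just u → u ∈ xs
firstAbove-∈ {v} (x ∷ xs) eq with v <ᵇ x
firstAbove-∈ (x ∷ xs) refl | true = here refl
... | false = there (firstAbove-∈ xs eq)

combInsert-tree : ∀ v B → All (v <_) (chainLabels B) → Unique (combWord B) →
  reinsert v (firstAbove v (combWord B)) (combTree B) ≡ combTree (combInsert v B)
combInsert-tree v [] _ _ = refl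
combInsert-tree v (([] , m) ∷ B) v<B (m∉B ∷ u) with v <ᵇ m
... | true rewrite ≡ᵇ-true (refl {x = m}) = refl
... | false = trans (reinsert-node v (firstAbove v (combWord B)) leaf m (combTree B) avoids)
                   (cong (node leaf m) (combInsert-tree v B v<B u))
  where
  avoids : ∀ {u} → firstAbove v (combWord B) ≡ just u → u ∉ [] × m ≢ u
  avoids eq = (λ ()) , All.lookup m∉B (firstAbove-∈ (combWord B) eq)
combInsert-tree v ((y ∷ c , m) ∷ B) (v<y ∷ _) (y∉ ∷ _)
  rewrite <ᵇ-true v<y | ≡ᵇ-false (All.lookup y∉ (∈-++⁺ʳ c (here refl)) ∘ sym) | ≡ᵇ-true (refl {x = y})
        | insAbove-∉ {v} (combTree B)
            (λ y∈ → All.lookup y∉ (∈-++⁺ʳ c (there (subst (y ∈_) (inorder-combTree B) y∈))) refl) = refl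

combWord-combInsert : ∀ v B → All (v <_) (chainLabels B) →
  combWord (combInsert v B) ≡ insertBeforeAbove v (combWord B)
combWord-combInsert v [] _ = refl
combWord-combInsert v (([] , m) ∷ B) v<B with v <ᵇ m
... | true = refl
... | false = cong (m ∷_) (combWord-combInsert v B v<B)
combWord-combInsert v ((y ∷ c , m) ∷ B) (v<y ∷ _) rewrite <ᵇ-true v<y = refl

chainEnds-combInsert : ∀ v B → chainEnds (combInsert v B) ≡ chainEnds B
chainEnds-combInsert v [] = refl
chainEnds-combInsert v (([] , m) ∷ B) with v <ᵇ m
... | true = refl
... | false = chainEnds-combInsert v B
chainEnds-combInsert v ((y ∷ c , m) ∷ B) = refl

Comb-combInsert : ∀ {v B} → Comb B → All (v <_) (chainLabels B) → v ∉ combWord B → Comb (combInsert v B)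
Comb-combInsert {v} [] _ _ = block [] [] [] [] []
Comb-combInsert {v} (block {[]} {m} {B} [] [] m<B [] comb) v<B v∉ with <-cmp v m
... | tri< v<m _ _ rewrite <ᵇ-true v<m =
  block [] [] (v<m ∷ All.map (<-trans v<m) m<B) [] (block [] [] m<B [] comb)
... | tri≈ _ v≡m _ = ⊥-elim (v∉ (here v≡m))
... | tri> v≮m _ m<v rewrite <ᵇ-false v≮m =
  block [] [] (subst (All (m <_)) (sym (combWord-combInsert v B v<B)) (All-insertBeforeAbove v _ m<v m<B)) []
        (Comb-combInsert comb v<B (v∉ ∘ there))
Comb-combInsert {v} (block {y ∷ c} asc m<end m<B c≺B comb) v<B _ =
  block (Allₚ.++⁻ˡ (y ∷ c) v<B ∷ asc) m<end m<B (Allₚ.++⁻ʳ (y ∷ c) v<B ∷ c≺B) comb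

rft-combTree-chainEnd : ∀ c v m B → rft v (combTree ((c ∷ʳ v , m) ∷ B)) ≡ firstAbove v (combWord B)
rft-combTree-chainEnd c v m B =
  trans (rft-node-∈ (chainTree (c ∷ʳ v)) m (combTree B)
                    (subst (v ∈_) (sym (inorder-chainTree (c ∷ʳ v))) (∈-++⁺ʳ c (here refl))))
        (cong (firstAbove v) (inorder-combTree B))

cut-chainTree-end : ∀ c {v} → v ∉ c → cut v (chainTree (c ∷ʳ v)) ≡ chainTree c
cut-chainTree-end [] {v} _ rewrite ≡ᵇ-true (refl {x = v}) = refl
cut-chainTree-end (x ∷ c) v∉ rewrite ≡ᵇ-false (v∉ ∘ here ∘ sym) | cut-chainTree-end c (v∉ ∘ there) = refl

θ-combTree-chainEnd : ∀ c v m B → All (v <_) (chainLabels B) → Unique ((c ∷ʳ v) ++ m ∷ combWord B) →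
  θ v (combTree ((c ∷ʳ v , m) ∷ B)) ≡ combTree ((c , m) ∷ combInsert v B)
θ-combTree-chainEnd c v m B v<B uniq = begin
  θ v T
    ≡⟨ θ-reinsert v T ⟩
  reinsert v (rft v T) (cut v T)
    ≡⟨ cong₂ (reinsert v) (rft-combTree-chainEnd c v m B) cut≡ ⟩
  reinsert v (firstAbove v W) (node (chainTree c) m (combTree B))
    ≡⟨ reinsert-node v _ (chainTree c) m (combTree B) avoids ⟩
  node (chainTree c) m (reinsert v (firstAbove v W) (combTree B))
    ≡⟨ cong (node (chainTree c) m) (combInsert-tree v B v<B uW) ⟩
  node (chainTree c) m (combTree (combInsert v B)) ∎
  where
  open ≡-Reasoning
  T = combTree ((c ∷ʳ v , m) ∷ B)
  W = combWord B
  disjoint : ∀ {a b} → a ∈ c ∷ʳ v → b ∈ m ∷ W → a ≢ b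
  disjoint = Unique-++-disjoint (c ∷ʳ v) uniq
  m∉W = proj₁ (proj₂ (Unique-++-∷⁻ (c ∷ʳ v) uniq))
  uW = proj₂ (proj₂ (proj₂ (Unique-++-∷⁻ (c ∷ʳ v) uniq)))
  v∉c = proj₁ (Unique-++-∷⁻ c (Unique-++⁻ˡ (c ∷ʳ v) uniq))
  v∈cv : v ∈ c ∷ʳ v
  v∈cv = ∈-++⁺ʳ c (here refl)
  cut≡ : cut v T ≡ node (chainTree c) m (combTree B)
  cut≡ rewrite ≡ᵇ-false (disjoint v∈cv (here refl) ∘ sym) | cut-chainTree-end c v∉c
             | cut-∉ (combTree B) (λ v∈ → disjoint v∈cv (there (subst (v ∈_) (inorder-combTree B) v∈)) refl)
             = refl
  avoids : ∀ {u} → firstAbove v W ≡ just u → u ∉ inorder (chainTree c) × m ≢ u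
  avoids eq = let u∈W = firstAbove-∈ W eq in
    (λ u∈c → disjoint (∈-++⁺ˡ (subst (_ ∈_) (inorder-chainTree c) u∈c)) (there u∈W) refl) ,
    (λ m≡u → m∉W (subst (_∈ W) (sym m≡u) u∈W))

Unique-combWord-++⁻ʳ : ∀ P {B} → Unique (combWord (P ++ B)) → Unique (combWord B)
Unique-combWord-++⁻ʳ P uniq = Unique-++⁻ʳ (combWord P) (subst Unique (combWord-++ P _) uniq)

chainEnd-∉ : ∀ c (v : ℕ) m W → Unique ((c ∷ʳ v) ++ m ∷ W) → v ∉ W
chainEnd-∉ c v m W uniq v∈W = Unique-++-disjoint (c ∷ʳ v) uniq (∈-++⁺ʳ c (here refl)) (there v∈W) refl

θ-combTree-step : ∀ P c v m B → All (v <_) (chainLabels B) → Unique (combWord (P ++ (c ∷ʳ v , m) ∷ B)) →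
  θ v (combTree (P ++ (c ∷ʳ v , m) ∷ B)) ≡ combTree (P ++ (c , m) ∷ combInsert v B)
θ-combTree-step P c v m B v<B uniq =
  θ-combTree-++ P v∉P rft∉P (θ-combTree-chainEnd c v m B v<B (Unique-combWord-++⁻ʳ P uniq))
  where
  uniq′ = subst Unique (combWord-++ P _) uniq
  ∉P : ∀ {a} → a ∈ combWord ((c ∷ʳ v , m) ∷ B) → a ∉ combWord P
  ∉P a∈ a∈P = Unique-++-disjoint (combWord P) uniq′ a∈P a∈ refl
  v∉P = ∉P (∈-++⁺ˡ (∈-++⁺ʳ c (here refl)))
  rft∉P : ∀ {u} → rft v (combTree ((c ∷ʳ v , m) ∷ B)) ≡ just u → u ∉ combWord P
  rft∉P eq =
    ∉P (∈-++⁺ʳ (c ∷ʳ v) (there (firstAbove-∈ (combWord B) (trans (sym (rft-combTree-chainEnd c v m B)) eq))))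

combWord-step-↭ : ∀ P c v m B → All (v <_) (chainLabels B) →
  combWord (P ++ (c ∷ʳ v , m) ∷ B) ↭ combWord ((P ∷ʳ (c , m)) ++ combInsert v B)
combWord-step-↭ P c v m B v<B = begin
  combWord (P ++ (c ∷ʳ v , m) ∷ B)                  ≡⟨ combWord-++ P _ ⟩
  combWord P ++ (c ∷ʳ v) ++ m ∷ W                   ≡⟨ cong (combWord P ++_) (++-assoc c [ v ] (m ∷ W)) ⟩
  combWord P ++ c ++ v ∷ m ∷ W                      ↭⟨ ++⁺ˡ (combWord P) (++⁺ˡ c (↭-swap v m ↭-refl)) ⟩
  combWord P ++ c ++ m ∷ v ∷ W
    ↭⟨ ++⁺ˡ (combWord P) (++⁺ˡ c (↭-prep m (↭-sym (insertBeforeAbove-↭ v W)))) ⟩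
  combWord P ++ c ++ m ∷ insertBeforeAbove v W
    ≡⟨ cong (λ w → combWord P ++ c ++ m ∷ w) (combWord-combInsert v B v<B) ⟨
  combWord P ++ combWord ((c , m) ∷ combInsert v B) ≡⟨ combWord-++ P _ ⟨
  combWord (P ++ (c , m) ∷ combInsert v B)          ≡⟨ cong combWord (++-assoc P _ _) ⟨
  combWord ((P ∷ʳ (c , m)) ++ combInsert v B)       ∎
  where
  open PermutationReasoning
  W = combWord B

-- Θ on combs

θ-fold : Tree → List ℕ → Tree
θ-fold = foldl (λ S v → θ v S)

-- P is the part of the comb already settled: the steps θ_v for the chain ends v of B never touch it.
FoldSorts : List Block → List Block → Set
FoldSorts P B =
  ∃[ S ] θ-fold (combTree (P ++ B)) (chainEnds B) ≡ combTree (P ++ S) × combWord S ≡ stackRun [] (combWord B)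

FoldSorts-spine : ∀ P m B → All (m <_) (combWord B) →
  FoldSorts (P ∷ʳ ([] , m)) B → FoldSorts P (([] , m) ∷ B)
FoldSorts-spine P m B m<B (S , fold≡ , word≡) =
  ([] , m) ∷ S ,
  (begin
    θ-fold (combTree (P ++ ([] , m) ∷ B)) (chainEnds B)
      ≡⟨ cong (λ Q → θ-fold (combTree Q) (chainEnds B)) (++-assoc P _ B) ⟨
    θ-fold (combTree ((P ∷ʳ ([] , m)) ++ B)) (chainEnds B) ≡⟨ fold≡ ⟩
    combTree ((P ∷ʳ ([] , m)) ++ S)                        ≡⟨ cong combTree (++-assoc P _ S) ⟩
    combTree (P ++ ([] , m) ∷ S)                           ∎) ,
  trans (cong (m ∷_) word≡) (sym (stackRun-singleton-min m _ m<B))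
  where open ≡-Reasoning

FoldSorts-chainEnd : ∀ P c v m B → AllPairs _<_ (c ∷ʳ v) → m < v → All (m <_) (combWord B) →
  All (v <_) (chainLabels B) → Unique (combWord (P ++ (c ∷ʳ v , m) ∷ B)) →
  FoldSorts (P ∷ʳ (c , m)) (combInsert v B) → FoldSorts P ((c ∷ʳ v , m) ∷ B)
FoldSorts-chainEnd P c v m B asc m<v m<B v<B uniq (S , fold≡ , word≡) =
  (c , m) ∷ S ,
  (begin
    θ-fold T (chainEnd (c ∷ʳ v) ++ chainEnds B)
      ≡⟨ cong (λ ends → θ-fold T (ends ++ chainEnds B)) (chainEnd-∷ʳ c v) ⟩
    θ-fold (θ v T) (chainEnds B)
      ≡⟨ cong₂ θ-fold (θ-combTree-step P c v m B v<B uniq) (sym (chainEnds-combInsert v B)) ⟩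
    θ-fold (combTree (P ++ (c , m) ∷ B′)) (chainEnds B′)
      ≡⟨ cong (λ Q → θ-fold (combTree Q) (chainEnds B′)) (++-assoc P _ B′) ⟨
    θ-fold (combTree ((P ∷ʳ (c , m)) ++ B′)) (chainEnds B′) ≡⟨ fold≡ ⟩
    combTree ((P ∷ʳ (c , m)) ++ S)                          ≡⟨ cong combTree (++-assoc P _ S) ⟩
    combTree (P ++ (c , m) ∷ S)                             ∎) ,
  (begin
    c ++ m ∷ combWord S
      ≡⟨ cong (λ w → c ++ m ∷ w) (trans word≡ (cong (stackRun []) (combWord-combInsert v B v<B))) ⟩
    c ++ m ∷ stackRun [] (insertBeforeAbove v W)
      ≡⟨ stackRun-chain-spine c v m W asc m<v m<B v∉W ⟨
    stackRun [] ((c ∷ʳ v) ++ m ∷ W) ∎)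
  where
  open ≡-Reasoning
  T = combTree (P ++ (c ∷ʳ v , m) ∷ B)
  B′ = combInsert v B
  W = combWord B
  v∉W = chainEnd-∉ c v m W (Unique-combWord-++⁻ʳ P uniq)

θ-fold-combTree : ∀ k P B → length (combWord B) ≤ k → Comb B → Unique (combWord (P ++ B)) → FoldSorts P B
θ-fold-combTree k P [] _ _ _ = [] , refl , refl
θ-fold-combTree zero P ((c , m) ∷ B) len _ _ with subst (_≤ 0) (length-++-∷ c m (combWord B)) len
... | ()
θ-fold-combTree (suc k) P ((c , m) ∷ B) len (block asc m<end m<B c≺B comb) uniq with initLast c
... | [] = FoldSorts-spine P m B m<B
  (θ-fold-combTree k (P ∷ʳ ([] , m)) B (s≤s⁻¹ len) comb
                   (subst (Unique ∘ combWord) (sym (++-assoc P _ B)) uniq))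
... | c′ ∷ʳ′ v = FoldSorts-chainEnd P c′ v m B asc m<v m<B v<B uniq
  (θ-fold-combTree k (P ∷ʳ (c′ , m)) (combInsert v B) len′ (Comb-combInsert comb v<B v∉B)
                   (Unique-resp-↭ (combWord-step-↭ P c′ v m B v<B) uniq))
  where
  m<v : m < v
  m<v with subst (All (m <_)) (chainEnd-∷ʳ c′ v) m<end
  ... | m<v ∷ [] = m<v
  v<B = All.lookup c≺B (∈-++⁺ʳ c′ (here refl))
  v∉B = chainEnd-∉ c′ v m (combWord B) (Unique-combWord-++⁻ʳ P uniq)
  len′ : length (combWord (combInsert v B)) ≤ k
  len′ = proj₂ (length-split-≤ c′ m _
                (subst (_≤ suc k) (↭-length (combWord-step-↭ [] c′ v m B v<B)) len))

Θ-combTree : ∀ {B} → Comb B → Θ (combTree B) ≡ θ-fold (combTree B) (chainEnds B)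
Θ-combTree {B} comb = cong (θ-fold (combTree B))
  (trans (cong sort (rightLeaves-combTree B)) (sort-ascending (chainEnds B) (chainEnds-ascending comb)))

Θ-combTree-stackRun : ∀ {B} → Comb B → Unique (combWord B) →
  inorder (Θ (combTree B)) ≡ stackRun [] (combWord B)
Θ-combTree-stackRun {B} comb uniq with θ-fold-combTree (length (combWord B)) [] B ≤-refl comb uniq
... | S , fold≡ , word≡ = begin
  inorder (Θ (combTree B))                          ≡⟨ cong inorder (trans (Θ-combTree comb) fold≡) ⟩
  inorder (combTree S)                              ≡⟨ inorder-combTree S ⟩
  combWord S                                        ≡⟨ word≡ ⟩
  stackRun [] (combWord B)                          ∎
  where open ≡-Reasoning

permutation-Unique : ∀ {n π} → π ↭ map suc (upTo n) → Unique π
permutation-Unique {n} perm = Unique-resp-↭ (↭-sym perm) (map⁺ suc-injective (upTo⁺ n))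

lemma3p12 : (n : ℕ) (π : List ℕ) → π ↭ map suc (upTo n) → Avoids321 π →
    Is321Tree (λt π) × stackSort π ≡ inorder (Θ (λt π))
lemma3p12 n π perm av with λt-comb (length π) π ≤-refl (permutation-Unique perm) av
... | B , comb , refl , λt≡ =
  subst Is321Tree (sym λt≡) (Is321Tree-combTree comb) ,
  (begin
    stackSort (combWord B)                ≡⟨ stackSortF≗stackRun _ (combWord B) ≤-refl uniq ⟩
    stackRun [] (combWord B)              ≡⟨ Θ-combTree-stackRun (IncreasingComb⇒Comb comb) uniq ⟨
    inorder (Θ (combTree B))              ≡⟨ cong (inorder ∘ Θ) λt≡ ⟨
    inorder (Θ (λt (combWord B)))         ∎)
  where
  open ≡-Reasoning
  uniq = permutation-Unique perm
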